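{- If $p$ is a Miller tree and $S\in[\omega]^\omega$, then exactly one of the following holds: (1) there is a Miller tree $q\le p$ with $[q]_{split}\subseteq[S]^\omega$; (2) there is $H:Split(p)\to\omega$ such that for every $f\in[p]$ the set $\{f\upharpoonright n\in Split(p): f(n)\in S\}$ is almost contained in $\{f\upharpoonright n\in Split(p): f(n)<H(f\upharpoonright n)\}$ (and then $[p]_{split}\cap Hit(S)\in\mathcal{K}(p)$).
   Context: A Miller tree is a nonempty tree $p\subseteq\omega^{<\omega}$ in which every node has an extension with infinitely many immediate successors; all Miller trees are assumed to consist of strictly increasing sequences. $q\le p$ means $q\subseteq p$ and $q$ is a Miller tree. $Split(p)$ is the set of nodes with infinitely many immediate successors, $[p]$ the set of branches of $p$. For $f\in[p]$, $Sp(p,f)=\{f(n): f\upharpoonright n\in Split(p)\}$, $[p]_{split}=\{Sp(p,f):f\in[p]\}$. For $G:Split(p)\to\omega$, $Catch_\exists(G)=\{Sp(p,f): f\in[p],\ \exists^\infty n\,(f\upharpoonright n\in Split(p)\wedge f(n)<G(f\upharpoonright n))\}$, and $\mathcal{K}(p)$ is the family of $A\subseteq[p]_{split}$ with $A\subseteq Catch_\exists(G)$ for some $G:Split(p)\to\omega$. $Hit(S)$ is the set of subsets of $\omega$ having infinite intersection with $S$. -}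

module Defs where

open import Data.Nat using (ℕ; _≤_; _<_)
open import Data.List using (List; []; _∷_; _++_; _∷ʳ_; map; upTo)
open import Data.List.Relation.Unary.Linked using (Linked)
open import Data.Product using (Σ; ∃; _×_)
open import Relation.Binary.PropositionalEquality using (_≡_)

Tree : Set₁
Tree = List ℕ → Set

InfinitelyMany : (ℕ → Set) → Set
InfinitelyMany P = ∀ m → ∃ λ n → m ≤ n × P n

restrict : (ℕ → ℕ) → ℕ → List ℕ
restrict f n = map f (upTo n)

Split : Tree → List ℕ → Set
Split p s = p s × InfinitelyMany (λ k → p (s ∷ʳ k))

record IsMillerTree (p : Tree) : Set where
  field
    nonempty    : ∃ λ s → p s
    closed      : ∀ s t → p (s ++ t) → p s
    increasing  : ∀ s → p s → Linked _<_ s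
    hasSplitExt : ∀ s → p s → ∃ λ t → Split p (s ++ t)

_≤ᴹ_ : Tree → Tree → Set
q ≤ᴹ p = IsMillerTree q × (∀ s → q s → p s)

Branch : Tree → (ℕ → ℕ) → Set
Branch p f = ∀ n → p (restrict f n)

Sp : Tree → (ℕ → ℕ) → ℕ → Set
Sp p f k = ∃ λ n → Split p (restrict f n) × f n ≡ k

_≐_ : (ℕ → Set) → (ℕ → Set) → Set
X ≐ Y = ∀ k → (X k → Y k) × (Y k → X k)

InfSubsetOf : (ℕ → Set) → (ℕ → Set) → Set
InfSubsetOf S X = (∀ k → X k → S k) × InfinitelyMany X

SplitSet : Tree → (ℕ → Set) → Set
SplitSet p X = ∃ λ f → Branch p f × (X ≐ Sp p f)

Hit : (ℕ → Set) → (ℕ → Set) → Set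
Hit S X = InfinitelyMany (λ k → X k × S k)

-- X ∈ Catch_∃(G)   (G : Split(p) → ω, represented as a function on all nodes;
-- only its values on Split(p) matter)
CatchExists : Tree → (List ℕ → ℕ) → (ℕ → Set) → Set
CatchExists p G X =
  ∃ λ f → Branch p f × (X ≐ Sp p f)
        × InfinitelyMany (λ n → Split p (restrict f n) × f n < G (restrict f n))

InK : Tree → ((ℕ → Set) → Set) → Set₁
InK p A = (∀ X → A X → SplitSet p X)
        × Σ (List ℕ → ℕ) (λ G → ∀ X → A X → CatchExists p G X)

Alt1 : Tree → (ℕ → Set) → Set₁
Alt1 p S = Σ Tree λ q → q ≤ᴹ p × (∀ f → Branch q f → InfSubsetOf S (Sp q f))

-- alternative (2): ∃ H : Split(p) → ω such that for all f ∈ [p],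
-- {f↾n ∈ Split(p) : f(n) ∈ S} ⊆* {f↾n ∈ Split(p) : f(n) < H(f↾n)}
-- (distinct n give distinct nodes f↾n, so "almost contained" = all but
-- boundedly many n)
Alt2 : Tree → (ℕ → Set) → Set
Alt2 p S = Σ (List ℕ → ℕ) λ H → ∀ f → Branch p f →
  ∃ λ m → ∀ n → m ≤ n → Split p (restrict f n) → S (f n) → f n < H (restrict f n)

-- Call a node s of p caught if, inductively, every splitting node t ⊇ s has a bound b such that
-- every successor t⌢k with k ∈ S and k ≥ b is again caught.  If the root is caught, let H at a
-- node be the largest bound of the derivation nodes met along it: whenever a branch takes an
-- S-value at a splitting node beyond the current bound it moves down to a caught child, one step
-- down a well-founded derivation, so this happens only finitely often, which is (2).  If the root
-- is not caught, every non-caught node has a splitting extension with infinitely many non-caught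
-- successors in S; fusing these choices gives a Miller tree q ≤ p whose splitting values all lie
-- in S, which is (1).  Both cannot hold, because every Miller tree q has a branch escaping any H
-- at infinitely many splitting nodes.  Finally, under (2) a branch whose splitting values meet S
-- infinitely often takes infinitely many splitting values below H, so H witnesses 𝒦(p).

module Submission where

open import Defs
open import Level using (lift; lower) renaming (suc to lsuc; zero to lzero)
open import Axiom.ExcludedMiddle using (ExcludedMiddle)
open import Data.Nat using (ℕ; zero; suc; _+_; _≤_; _<_; _⊔_; z≤n; s≤s)
open import Data.Nat.Properties
open import Data.List using (List; []; _∷_; _++_; _∷ʳ_; map; upTo; applyUpTo; length)
open import Data.List.Relation.Unary.Linked using (Linked; _∷_)
open import Data.List.Properties using (map-upTo; applyUpTo-∷ʳ; ++-assoc; ++-identityʳ; length-++; length-++-≤ˡ; ∷ʳ-injectiveˡ; ∷ʳ-injectiveʳ)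
open import Data.Product using (Σ; ∃; _×_; _,_; proj₁; proj₂; map₁; map₂; uncurry)
open import Data.Unit using (⊤; tt)
open import Data.Empty using (⊥; ⊥-elim)
open import Data.Sum using (_⊎_; inj₁; inj₂)
open import Relation.Nullary using (¬_; Dec; yes; no)
open import Relation.Nullary.Decidable using (map′; dec-yes; decidable-stable)
open import Relation.Binary.PropositionalEquality

restrict-suc : ∀ f n → restrict f (suc n) ≡ restrict f n ∷ʳ f n
restrict-suc f n = begin
  map f (upTo (suc n))     ≡⟨ map-upTo f (suc n) ⟩
  applyUpTo f (suc n)      ≡⟨ applyUpTo-∷ʳ f n ⟨
  applyUpTo f n ∷ʳ f n     ≡⟨ cong (_∷ʳ f n) (map-upTo f n) ⟨
  restrict f n ∷ʳ f n      ∎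
  where open ≡-Reasoning

restrict-+ : ∀ f m n → restrict f (m + n) ≡ restrict f m ++ restrict (λ i → f (m + i)) n
restrict-+ f m zero = begin
  restrict f (m + 0)  ≡⟨ cong (restrict f) (+-identityʳ m) ⟩
  restrict f m        ≡⟨ ++-identityʳ (restrict f m) ⟨
  restrict f m ++ []  ∎
  where open ≡-Reasoning
restrict-+ f m (suc n) = begin
  restrict f (m + suc n)                      ≡⟨ cong (restrict f) (+-suc m n) ⟩
  restrict f (suc (m + n))                    ≡⟨ restrict-suc f (m + n) ⟩
  restrict f (m + n) ∷ʳ f (m + n)             ≡⟨ cong (_∷ʳ f (m + n)) (restrict-+ f m n) ⟩
  (restrict f m ++ restrict g n) ∷ʳ g n       ≡⟨ ++-assoc (restrict f m) (restrict g n) _ ⟩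
  restrict f m ++ (restrict g n ∷ʳ g n)       ≡⟨ cong (restrict f m ++_) (restrict-suc g n) ⟨
  restrict f m ++ restrict g (suc n)          ∎
  where
  open ≡-Reasoning
  g : ℕ → ℕ
  g i = f (m + i)

restrict-suc-+ : ∀ f d e → restrict f (suc d + e) ≡ restrict f d ++ f d ∷ restrict (λ i → f (suc d + i)) e
restrict-suc-+ f d e = begin
  restrict f (suc d + e)                               ≡⟨ restrict-+ f (suc d) e ⟩
  restrict f (suc d) ++ restrict g e                   ≡⟨ cong (_++ restrict g e) (restrict-suc f d) ⟩
  (restrict f d ∷ʳ f d) ++ restrict g e                ≡⟨ ++-assoc (restrict f d) (f d ∷ []) (restrict g e) ⟩
  restrict f d ++ f d ∷ restrict g e                   ∎
  where
  open ≡-Reasoning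
  g : ℕ → ℕ
  g i = f (suc d + i)

++-restrict-suc-+ : ∀ s f d e →
  s ++ restrict f (suc d + e) ≡ ((s ++ restrict f d) ∷ʳ f d) ++ restrict (λ i → f (suc d + i)) e
++-restrict-suc-+ s f d e = begin
  s ++ restrict f (suc d + e)                ≡⟨ cong (s ++_) (restrict-suc-+ f d e) ⟩
  s ++ (restrict f d ++ f d ∷ restrict g e)  ≡⟨ ++-assoc s (restrict f d) _ ⟨
  t ++ f d ∷ restrict g e                    ≡⟨ ++-assoc t (f d ∷ []) (restrict g e) ⟨
  (t ∷ʳ f d) ++ restrict g e                 ∎
  where
  open ≡-Reasoning
  t = s ++ restrict f d
  g : ℕ → ℕ
  g i = f (suc d + i)

Eventually : (ℕ → Set) → Set
Eventually P = ∃ λ m → ∀ n → m ≤ n → P n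

eventually-shift : ∀ {P : ℕ → Set} k → Eventually (λ n → P (k + n)) → Eventually P
eventually-shift {P} k (m , later) = k + m , beyond
  where
  beyond : ∀ n → k + m ≤ n → P n
  beyond n le with m≤n⇒∃[o]m+o≡n le
  ... | o , refl = subst P (sym (+-assoc k m o)) (later (m + o) (m≤m+n m o))

Linked-applyUpTo⁻ : ∀ {R : ℕ → ℕ → Set} f n → Linked R (applyUpTo f (suc (suc n))) → R (f n) (f (suc n))
Linked-applyUpTo⁻ f zero    (r ∷ _)  = r
Linked-applyUpTo⁻ f (suc n) (_ ∷ rs) = Linked-applyUpTo⁻ (λ i → f (suc i)) n rs

module _ {p : Tree} (mp : IsMillerTree p) {f : ℕ → ℕ} (branch : Branch p f) where

  branch-<-suc : ∀ n → f n < f (suc n)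
  branch-<-suc n = Linked-applyUpTo⁻ f n
    (subst (Linked _<_) (map-upTo f (suc (suc n))) (IsMillerTree.increasing mp _ (branch (suc (suc n)))))

  branch-≥ : ∀ n → n ≤ f n
  branch-≥ zero    = z≤n
  branch-≥ (suc n) = ≤-<-trans (branch-≥ n) (branch-<-suc n)

  branch-mono-≤ : ∀ {m n} → m ≤ n → f m ≤ f n
  branch-mono-≤ {m} le with m≤n⇒∃[o]m+o≡n le
  ... | o , refl = mono-+ o
    where
    mono-+ : ∀ o → f m ≤ f (m + o)
    mono-+ zero    = ≤-reflexive (cong f (sym (+-identityʳ m)))
    mono-+ (suc o) = ≤-trans (mono-+ o) (≤-trans (<⇒≤ (branch-<-suc (m + o))) (≤-reflexive (cong f (sym (+-suc m o)))))

  branch-cancel-< : ∀ {m n} → f m < f n → m < n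
  branch-cancel-< lt = ≰⇒> λ n≤m → <⇒≱ lt (branch-mono-≤ n≤m)

nth : ℕ → List ℕ → ℕ
nth _       []       = 0
nth zero    (x ∷ _)  = x
nth (suc n) (_ ∷ xs) = nth n xs

nth-++ˡ : ∀ n xs ys → n < length xs → nth n (xs ++ ys) ≡ nth n xs
nth-++ˡ zero    (x ∷ xs) ys _        = refl
nth-++ˡ (suc n) (x ∷ xs) ys (s≤s lt) = nth-++ˡ n xs ys lt

applyUpTo-nth : ∀ xs g → (∀ m → m < length xs → g m ≡ nth m xs) → applyUpTo g (length xs) ≡ xs
applyUpTo-nth []       g agree = refl
applyUpTo-nth (x ∷ xs) g agree =
  cong₂ _∷_ (agree 0 (s≤s z≤n)) (applyUpTo-nth xs (λ i → g (suc i)) (λ m lt → agree (suc m) (s≤s lt)))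

module Chain (σ : ℕ → List ℕ) (grows : ∀ i → ∃ λ e → σ (suc i) ≡ σ i ++ e) (long : ∀ i → i ≤ length (σ i)) where

  chain-prefix-+ : ∀ i o → ∃ λ e → σ (i + o) ≡ σ i ++ e
  chain-prefix-+ i zero    = [] , trans (cong σ (+-identityʳ i)) (sym (++-identityʳ (σ i)))
  chain-prefix-+ i (suc o) =
    let (e , σo) = chain-prefix-+ i o
        (e′ , σo′) = grows (i + o)
    in e ++ e′ , (begin
      σ (i + suc o)         ≡⟨ cong σ (+-suc i o) ⟩
      σ (suc (i + o))       ≡⟨ σo′ ⟩
      σ (i + o) ++ e′       ≡⟨ cong (_++ e′) σo ⟩
      (σ i ++ e) ++ e′      ≡⟨ ++-assoc (σ i) e e′ ⟩
      σ i ++ (e ++ e′)      ∎)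
    where open ≡-Reasoning

  chain-prefix : ∀ {i j} → i ≤ j → ∃ λ e → σ j ≡ σ i ++ e
  chain-prefix {i} le with m≤n⇒∃[o]m+o≡n le
  ... | o , refl = chain-prefix-+ i o

  limit : ℕ → ℕ
  limit n = nth n (σ (suc n))

  limit-nth : ∀ i m → m < length (σ i) → limit m ≡ nth m (σ i)
  limit-nth i m lt with ≤-total (suc m) i
  ... | inj₁ sm≤i = let (e , σi) = chain-prefix sm≤i in
    sym (trans (cong (nth m) σi) (nth-++ˡ m (σ (suc m)) e (long (suc m))))
  ... | inj₂ i≤sm = let (e , σsm) = chain-prefix i≤sm in
    trans (cong (nth m) σsm) (nth-++ˡ m (σ i) e lt)

  restrict-limit : ∀ i → restrict limit (length (σ i)) ≡ σ i
  restrict-limit i = trans (map-upTo limit (length (σ i))) (applyUpTo-nth (σ i) limit (limit-nth i))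

  limit-prefix : ∀ n → ∃ λ e → σ n ≡ restrict limit n ++ e
  limit-prefix n with m≤n⇒∃[o]m+o≡n (long n)
  ... | o , reach = restrict (λ i → limit (n + i)) o ,
    trans (sym (restrict-limit n)) (trans (cong (restrict limit) (sym reach)) (restrict-+ limit n o))

Split-mono : ∀ {p q : Tree} → (∀ s → q s → p s) → ∀ {t} → Split q t → Split p t
Split-mono q⊆p (qt , frequent) = q⊆p _ qt , λ m → let (k , le , qk) = frequent m in k , le , q⊆p _ qk

module _ {q : Tree} (mq : IsMillerTree q) (H : List ℕ → ℕ) where
  open IsMillerTree mq

  private
    splitting : Σ (List ℕ) q → List ℕ
    splitting (t , qt) = t ++ proj₁ (hasSplitExt t qt)

    splitting-split : ∀ x → Split q (splitting x)
    splitting-split (t , qt) = proj₂ (hasSplitExt t qt)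

    escape : Σ (List ℕ) q → ℕ
    escape x = proj₁ (proj₂ (splitting-split x) (H (splitting x)))

    escape-≥ : ∀ x → H (splitting x) ≤ escape x
    escape-≥ x = proj₁ (proj₂ (proj₂ (splitting-split x) (H (splitting x))))

    jump : Σ (List ℕ) q → Σ (List ℕ) q
    jump x = splitting x ∷ʳ escape x , proj₂ (proj₂ (proj₂ (splitting-split x) (H (splitting x))))

    node : ℕ → Σ (List ℕ) q
    node zero    = nonempty
    node (suc i) = jump (node i)

    σ : ℕ → List ℕ
    σ i = proj₁ (node i)

    length-jump : ∀ x → suc (length (splitting x)) ≡ length (proj₁ (jump x))
    length-jump x = trans (+-comm 1 _) (sym (length-++ (splitting x)))

    grows : ∀ i → ∃ λ e → σ (suc i) ≡ σ i ++ e
    grows i = _ , ++-assoc (σ i) _ (escape (node i) ∷ [])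

    long : ∀ i → i ≤ length (σ i)
    long zero    = z≤n
    long (suc i) = ≤-trans (s≤s (≤-trans (long i) (length-++-≤ˡ (σ i)))) (≤-reflexive (length-jump (node i)))

  open Chain σ grows long

  escaping-branch : ∃ λ f → Branch q f × InfinitelyMany (λ n → Split q (restrict f n) × H (restrict f n) ≤ f n)
  escaping-branch = limit , on-q , escapes
    where
    on-q : Branch q limit
    on-q n = let (e , σn) = limit-prefix n in closed (restrict limit n) e (subst q σn (proj₂ (node n)))

    escapes : InfinitelyMany (λ n → Split q (restrict limit n) × H (restrict limit n) ≤ limit n)
    escapes m = n , ≤-trans (long m) (length-++-≤ˡ (σ m)) ,
      subst (Split q) (sym at) (splitting-split (node m)) ,
      subst₂ _≤_ (cong H (sym at)) (sym value) (escape-≥ (node m))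
      where
      n = length (splitting (node m))
      jumped : restrict limit n ∷ʳ limit n ≡ splitting (node m) ∷ʳ escape (node m)
      jumped = begin
        restrict limit n ∷ʳ limit n               ≡⟨ restrict-suc limit n ⟨
        restrict limit (suc n)                     ≡⟨ cong (restrict limit) (length-jump (node m)) ⟩
        restrict limit (length (σ (suc m)))        ≡⟨ restrict-limit (suc m) ⟩
        splitting (node m) ∷ʳ escape (node m)      ∎
        where open ≡-Reasoning
      at = ∷ʳ-injectiveˡ (restrict limit n) (splitting (node m)) jumped
      value = ∷ʳ-injectiveʳ (restrict limit n) (splitting (node m)) jumped

alt1-alt2-incompatible : ∀ {p S} → Alt1 p S → Alt2 p S → ⊥
alt1-alt2-incompatible (q , (mq , q⊆p) , spS) (H , bounded) with escaping-branch mq H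
... | f , branch , escapes with bounded f (λ n → q⊆p _ (branch n))
... | m , below with escapes m
... | n , m≤n , split , H≤fn =
  <⇒≱ (below n m≤n (Split-mono q⊆p split) (proj₁ (spS f branch) (f n) (n , split , refl))) H≤fn

alt2⇒inK : ∀ {p S} → IsMillerTree p → Alt2 p S → InK p (λ X → SplitSet p X × Hit S X)
alt2⇒inK {p} {S} mp (H , bounded) =
  (λ _ → proj₁) , H , λ { X ((f , branch , X≐Sp) , hit) → f , branch , X≐Sp , catches f branch X≐Sp hit }
  where
  catches : ∀ {X} f → Branch p f → X ≐ Sp p f → Hit S X →
    InfinitelyMany (λ n → Split p (restrict f n) × f n < H (restrict f n))
  catches f branch X≐Sp hit m with bounded f branch
  ... | m₀ , below with hit (suc (f (m ⊔ m₀)))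
  ... | k , lt , Xk , Sk with proj₁ (X≐Sp k) Xk
  ... | n , split , refl =
    n , ≤-trans (m≤m⊔n m m₀) (<⇒≤ late) , split , below n (≤-trans (m≤n⊔m m m₀) (<⇒≤ late)) split Sk
    where
    late : m ⊔ m₀ < n
    late = branch-cancel-< mp branch lt

module Dichotomy (em : ExcludedMiddle (lsuc lzero)) (p : Tree) (S : ℕ → Set) where

  decide : (P : Set) → Dec P
  decide P = map′ lower lift em

  -- Nodes above s are addressed relative to s: bound u is the bound at the node s ++ u.
  data Caught (s : List ℕ) : Set where
    caught : (bound : List ℕ → ℕ)
           → (∀ u k → Split p (s ++ u) → bound u ≤ k → S k → p ((s ++ u) ∷ʳ k) → Caught ((s ++ u) ∷ʳ k))
           → Caught s

  CaughtSucc : ∀ {s} → (List ℕ → ℕ) → List ℕ → ℕ → Set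
  CaughtSucc {s} bound u k = Split p (s ++ u) × bound u ≤ k × S k × p ((s ++ u) ∷ʳ k)

  -- catchBound r v is the largest bound of the derivation nodes of r met along s ++ v.
  mutual
    catchBound : ∀ {s} → Caught s → List ℕ → ℕ
    catchBound r@(caught bound _) v = bound v ⊔ childBounds r [] v

    childBounds : ∀ {s} → Caught s → List ℕ → List ℕ → ℕ
    childBounds r u []      = 0
    childBounds r u (k ∷ w) = childBound r u k w ⊔ childBounds r (u ∷ʳ k) w

    childBound : ∀ {s} → Caught s → List ℕ → ℕ → List ℕ → ℕ
    childBound (caught bound next) u k w = childBoundOf next u k w (decide (CaughtSucc bound u k))

    childBoundOf : ∀ {s} {bound : List ℕ → ℕ}
      → (∀ u k → Split p (s ++ u) → bound u ≤ k → S k → p ((s ++ u) ∷ʳ k) → Caught ((s ++ u) ∷ʳ k))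
      → ∀ u k → List ℕ → Dec (CaughtSucc bound u k) → ℕ
    childBoundOf next u k w (yes (sp , le , sk , pk)) = catchBound (next u k sp le sk pk) w
    childBoundOf next u k w (no _)                    = 0

  -- Caught is proof relevant: childBound follows the child built from the proof chosen by decide.
  chosenSucc : ∀ {s} bound next u k → CaughtSucc {s} bound u k →
    Σ (CaughtSucc bound u k) λ where
      (sp , le , sk , pk) → ∀ w → childBound (caught bound next) u k w ≡ catchBound (next u k sp le sk pk) w
  chosenSucc bound next u k x with dec-yes (decide (CaughtSucc bound u k)) x
  ... | x′ , chosen = x′ , λ w → cong (childBoundOf next u k w) chosen

  childBound≤childBounds : ∀ {s} (r : Caught s) u v k w → childBound r (u ++ v) k w ≤ childBounds r u (v ++ k ∷ w)
  childBound≤childBounds r u [] k w rewrite ++-identityʳ u = m≤m⊔n _ _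
  childBound≤childBounds r u (x ∷ v) k w = ≤-trans
    (subst (λ t → childBound r t k w ≤ childBounds r (u ∷ʳ x) (v ++ k ∷ w)) (++-assoc u (x ∷ []) v)
      (childBound≤childBounds r (u ∷ʳ x) v k w))
    (m≤n⊔m (childBound r u x (v ++ k ∷ w)) _)

  childBound≤catchBound : ∀ {s} (r : Caught s) v k w → childBound r v k w ≤ catchBound r (v ++ k ∷ w)
  childBound≤catchBound r@(caught _ _) v k w = ≤-trans (childBound≤childBounds r [] v k w) (m≤n⊔m _ _)

  CatchesAt : ∀ {s} → Caught s → (ℕ → ℕ) → ℕ → Set
  CatchesAt {s} r g e = Split p (s ++ restrict g e) → S (g e) → g e < catchBound r (restrict g e)

  catches-from-child : ∀ {s} (r : Caught s) g d (r′ : Caught ((s ++ restrict g d) ∷ʳ g d)) →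
    (∀ w → childBound r (restrict g d) (g d) w ≡ catchBound r′ w) →
    ∀ e → CatchesAt r′ (λ i → g (suc d + i)) e → CatchesAt r g (suc d + e)
  catches-from-child {s} r g d r′ chosen e catches sp sk = begin-strict
    g′ e                                                <⟨ catches (subst (Split p) (++-restrict-suc-+ s g d e) sp) sk ⟩
    catchBound r′ (restrict g′ e)                        ≡⟨ chosen (restrict g′ e) ⟨
    childBound r (restrict g d) (g d) (restrict g′ e)    ≤⟨ childBound≤catchBound r (restrict g d) (g d) (restrict g′ e) ⟩
    catchBound r (restrict g d ++ g d ∷ restrict g′ e)   ≡⟨ cong (catchBound r) (restrict-suc-+ g d e) ⟨
    catchBound r (restrict g (suc d + e))                ∎
    where
    open ≤-Reasoning
    g′ : ℕ → ℕ
    g′ i = g (suc d + i)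

  catchBound-eventually : ∀ {s} (r : Caught s) g → (∀ e → p (s ++ restrict g e)) → Eventually (CatchesAt r g)
  catchBound-eventually {s} r@(caught bound next) g path
    with decide (∃ λ d → Split p (s ++ restrict g d) × S (g d) × bound (restrict g d) ≤ g d)
  ... | no never = 0 , λ e _ sp sk → <-≤-trans (≰⇒> λ le → never (e , sp , sk , le)) (m≤m⊔n _ _)
  ... | yes (d , sp , sk , le)
    with chosenSucc bound next (restrict g d) (g d)
           (sp , le , sk , subst p (trans (++-restrict-suc-+ s g d 0) (++-identityʳ _)) (path (suc d + 0)))
  ... | (sp′ , le′ , sk′ , pk′) , chosen =
    let child = next (restrict g d) (g d) sp′ le′ sk′ pk′ in
    eventually-shift (suc d) (map₂ (λ later e le → catches-from-child r g d child chosen e (later e le))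
      (catchBound-eventually child (λ i → g (suc d + i))
        (λ e → subst p (++-restrict-suc-+ s g d e) (path (suc d + e)))))

  caught⇒alt2 : Caught [] → Alt2 p S
  caught⇒alt2 r = catchBound r , catchBound-eventually r

  dne : {P : Set} → ¬ ¬ P → P
  dne = decidable-stable (decide _)

  FreeSucc : List ℕ → ℕ → Set
  FreeSucc t k = S k × p (t ∷ʳ k) × ¬ Caught (t ∷ʳ k)

  Branching : List ℕ → Set
  Branching t = Split p t × InfinitelyMany (FreeSucc t)

  no-branching⇒caught : ∀ s → ¬ (∃ λ u → Branching (s ++ u)) → Caught s
  no-branching⇒caught s none = caught (λ u → proj₁ (bounded u)) (λ u k sp → proj₂ (bounded u) sp k)
    where
    Bounded : List ℕ → ℕ → Set
    Bounded t b = ∀ k → b ≤ k → S k → p (t ∷ʳ k) → Caught (t ∷ʳ k)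

    unbounded⇒free : ∀ t → ¬ (∃ (Bounded t)) → InfinitelyMany (FreeSucc t)
    unbounded⇒free t unbounded m = dne λ bounded →
      unbounded (m , λ k le sk pk → dne λ ¬c → bounded (k , le , sk , pk , ¬c))

    bounded : ∀ u → ∃ λ b → Split p (s ++ u) → Bounded (s ++ u) b
    bounded u = dne λ unbounded →
      let sp = dne λ ¬sp → unbounded (0 , λ sp → ⊥-elim (¬sp sp))
      in none (u , sp , unbounded⇒free (s ++ u) λ (b , h) → unbounded (b , λ _ → h))

  -- [] is a junk value, used only when s is caught.
  stemOf : ∀ s → Dec (∃ λ u → Branching (s ++ u)) → List ℕ
  stemOf s (yes (u , _)) = u
  stemOf s (no _)        = []

  stem : List ℕ → List ℕ
  stem s = stemOf s (decide _)

  branchNode : List ℕ → List ℕ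
  branchNode s = s ++ stem s

  branchNode-branching : ∀ s → ¬ Caught s → Branching (branchNode s)
  branchNode-branching s ¬c with decide (∃ λ u → Branching (s ++ u))
  ... | yes (u , b) = b
  ... | no none     = ⊥-elim (¬c (no-branching⇒caught s none))

  -- An anchor s (a non-caught node) and the part of stem s still to be walked before branching.
  State : Set
  State = List ℕ × List ℕ

  Allowed : State → ℕ → Set
  Allowed (s , x ∷ _) y = y ≡ x
  Allowed (s , [])    k = FreeSucc (branchNode s) k

  advance : State → ℕ → State
  advance (s , _ ∷ pending) _ = s , pending
  advance (s , [])          k = branchNode s ∷ʳ k , stem (branchNode s ∷ʳ k)

  Path : State → List ℕ → Set
  Path st []      = ⊤
  Path st (y ∷ t) = Allowed st y × Path (advance st y) t

  after : State → List ℕ → State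
  after st []      = st
  after st (y ∷ t) = after (advance st y) t

  start : State
  start = [] , stem []

  fusion : Tree
  fusion = Path start

  Path-++⁻ : ∀ st a b → Path st (a ++ b) → Path st a × Path (after st a) b
  Path-++⁻ st []      b path         = tt , path
  Path-++⁻ st (y ∷ a) b (ok , path) = map₁ (ok ,_) (Path-++⁻ (advance st y) a b path)

  Path-++⁺ : ∀ st a b → Path st a → Path (after st a) b → Path st (a ++ b)
  Path-++⁺ st []      b _           path′ = path′
  Path-++⁺ st (y ∷ a) b (ok , path) path′ = ok , Path-++⁺ (advance st y) a b path path′

  after-++ : ∀ st a b → after st (a ++ b) ≡ after (after st a) b
  after-++ st []      b = refl
  after-++ st (y ∷ a) b = after-++ (advance st y) a b

  Tracks : State → List ℕ → Set
  Tracks (s , pending) t = t ++ pending ≡ branchNode s × ¬ Caught s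

  tracks-advance : ∀ st t y → Tracks st t → Allowed st y → Tracks (advance st y) (t ∷ʳ y)
  tracks-advance (s , x ∷ pending) t y (reaches , ¬c) refl = trans (++-assoc t (y ∷ []) pending) reaches , ¬c
  tracks-advance (s , [])          t k (reaches , ¬c) (_ , _ , ¬ck) =
    cong (λ u → (u ∷ʳ k) ++ stem (branchNode s ∷ʳ k)) (trans (sym (++-identityʳ t)) reaches) , ¬ck

  tracks-after : ∀ st t u → Tracks st t → Path st u → Tracks (after st u) (t ++ u)
  tracks-after st t []      tracks _           = subst (Tracks st) (sym (++-identityʳ t)) tracks
  tracks-after st t (y ∷ u) tracks (ok , path) =
    subst (Tracks _) (++-assoc t (y ∷ []) u) (tracks-after (advance st y) (t ∷ʳ y) u (tracks-advance st t y tracks ok) path)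

  AtBranch : State → Set
  AtBranch st = proj₂ st ≡ []

  frequently-allowed⇒at-branch : ∀ st → InfinitelyMany (Allowed st) → AtBranch st
  frequently-allowed⇒at-branch (s , [])    _        = refl
  frequently-allowed⇒at-branch (s , x ∷ _) frequent with frequent (suc x)
  ... | _ , x<k , refl = ⊥-elim (1+n≰n x<k)

  at-branch-allowed⇒S : ∀ st y → AtBranch st → Allowed st y → S y
  at-branch-allowed⇒S (s , []) y refl (sy , _) = sy

  at-branch⇒frequently-allowed : ∀ st → AtBranch st → ¬ Caught (proj₁ st) → InfinitelyMany (Allowed st)
  at-branch⇒frequently-allowed (s , []) refl ¬c = proj₂ (branchNode-branching s ¬c)

  walk-pending : ∀ s pending → Path (s , pending) pending × AtBranch (after (s , pending) pending)
  walk-pending s []            = tt , refl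
  walk-pending s (x ∷ pending) = map₁ (refl ,_) (walk-pending s pending)

  advance-pending : ∀ st y {x pending} → proj₂ st ≡ x ∷ pending → proj₂ (advance st y) ≡ pending
  advance-pending (s , _ ∷ _) y refl = refl

  after-∷ʳ : ∀ st t y → after st (t ∷ʳ y) ≡ advance (after st t) y
  after-∷ʳ st t y = after-++ st t (y ∷ [])

  split⇒at-branch : ∀ t → Split fusion t → AtBranch (after start t)
  split⇒at-branch t (path , frequent) = frequently-allowed⇒at-branch (after start t) λ m →
    let (k , le , path′) = frequent m in k , le , proj₁ (proj₂ (Path-++⁻ start t (k ∷ []) path′))

  module _ (mp : IsMillerTree p) (¬c : ¬ Caught []) where

    fusion-tracks : ∀ t → fusion t → Tracks (after start t) t
    fusion-tracks t = tracks-after start [] t (refl , ¬c)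

    fusion⊆p : ∀ t → fusion t → p t
    fusion⊆p t path with after start t | fusion-tracks t path
    ... | s , pending | reaches , ¬cs =
      IsMillerTree.closed mp t pending (subst p (sym reaches) (proj₁ (proj₁ (branchNode-branching s ¬cs))))

    fusion-split : ∀ t → fusion t → AtBranch (after start t) → Split fusion t
    fusion-split t path done = path , λ m →
      let (k , le , ok) = at-branch⇒frequently-allowed (after start t) done (proj₂ (fusion-tracks t path)) m
      in k , le , Path-++⁺ start t (k ∷ []) path (ok , tt)

    fusion-split-ext : ∀ t → fusion t → ∃ λ u → Split fusion (t ++ u)
    fusion-split-ext t path = pending , fusion-split (t ++ pending) (Path-++⁺ start t pending path walked)
      (subst AtBranch (sym (after-++ start t pending)) done)
      where
      pending = proj₂ (after start t)
      walked-done = walk-pending (proj₁ (after start t)) pending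
      walked = proj₁ walked-done
      done = proj₂ walked-done

    fusion-miller : IsMillerTree fusion
    fusion-miller = record
      { nonempty    = [] , tt
      ; closed      = λ s t path → proj₁ (Path-++⁻ start s t path)
      ; increasing  = λ s path → IsMillerTree.increasing mp s (fusion⊆p s path)
      ; hasSplitExt = fusion-split-ext
      }

    module _ {f : ℕ → ℕ} (branch : Branch fusion f) where

      allowed-along : ∀ n → Allowed (after start (restrict f n)) (f n)
      allowed-along n = proj₁ (proj₂ (Path-++⁻ start (restrict f n) (f n ∷ [])
        (subst fusion (restrict-suc f n) (branch (suc n)))))

      Sp-fusion⊆S : ∀ k → Sp fusion f k → S k
      Sp-fusion⊆S _ (n , split , refl) = at-branch-allowed⇒S _ (f n) (split⇒at-branch _ split) (allowed-along n)

      at-branch-from : ∀ m pending → proj₂ (after start (restrict f m)) ≡ pending →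
        ∃ λ n → m ≤ n × AtBranch (after start (restrict f n))
      at-branch-from m []            done = m , ≤-refl , done
      at-branch-from m (x ∷ pending) eq   =
        let (n , le , done) = at-branch-from (suc m) pending
              (trans (cong (λ t → proj₂ (after start t)) (restrict-suc f m))
                (trans (cong proj₂ (after-∷ʳ start (restrict f m) (f m)))
                  (advance-pending (after start (restrict f m)) (f m) eq)))
        in n , <⇒≤ le , done

      Sp-fusion-infinite : InfinitelyMany (Sp fusion f)
      Sp-fusion-infinite m with at-branch-from m _ refl
      ... | n , m≤n , done =
        f n , ≤-trans m≤n (branch-≥ fusion-miller branch n) , n , fusion-split _ (branch n) done , refl

    not-caught⇒alt1 : Alt1 p S
    not-caught⇒alt1 = fusion , (fusion-miller , fusion⊆p) , λ f branch → Sp-fusion⊆S branch , Sp-fusion-infinite branch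

corollary18 : ExcludedMiddle (lsuc lzero) →
    (p : Tree) → IsMillerTree p →
    (S : ℕ → Set) → InfinitelyMany S →
    (Alt1 p S ⊎ Alt2 p S) × ¬ (Alt1 p S × Alt2 p S)
      × (Alt2 p S → InK p (λ X → SplitSet p X × Hit S X))
corollary18 em p mp S _ = dichotomy , uncurry alt1-alt2-incompatible , alt2⇒inK mp
  where
  open Dichotomy em p S

  dichotomy : Alt1 p S ⊎ Alt2 p S
  dichotomy with decide (Caught [])
  ... | yes c  = inj₂ (caught⇒alt2 c)
  ... | no ¬c  = inj₁ (not-caught⇒alt1 mp ¬c)
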